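{- Let $n\ge 3$ and $\lambda\vdash n$ with exactly $p$ parts of size 1, $q$ parts of size 2 and $r$ parts of size 3. Define the seven functions $e_1=1$, $e_2=p-1$, $e_3=\binom{p-1}{2}+q-1$, $e_4=\binom{p-1}{2}-q$, $e_5=\binom{p-1}{3}+(p-1)(q-1)+r$, $e_6=2\binom{p-1}{3}-p-r+2$, $e_7=\binom{p-1}{3}-q(p-1)+r$ (these are the character values $\chi^{(n)},\chi^{(n-1,1)},\chi^{(n-2,2)},\chi^{(n-2,1,1)},\chi^{(n-3,3)},\chi^{(n-3,2,1)},\chi^{(n-3,1,1,1)}$ at $\lambda$ whenever the index is a partition of $n$), and let $\mathbf e=(e_1,\dots,e_7)^T$. Let $H_{31}=p(p-1)(p-2)$, $H_{32}=2pq$, $H_{33}=3r$, $H_{41}=p(p-1)(n-p)$, $H_{42}=2q(n-p-2)$, $H_{43}=p(n-p-2q)$, $H_{44}=n-p-2q-3r$, $H_{51}=p^3+3p^2+2pq-n(2p^2+3p)+n^2p$, $H_{52}=p^2+4p+2pq+8q+3r-n(2p+2q+4)+n^2$, $H_{61}=-p^3-9p^2-20p-6pq-24q-6r+n(3p^2+18p+6q+20)-n^2(3p+9)+n^3$. Then \begin{align*} H_{31}&=(1,3,3,3,1,2,1)\,\mathbf e,\\ H_{32}&=(1,1,1,-1,1,0,-1)\,\mathbf e,\\ H_{33}&=(1,0,0,0,1,-1,1)\,\mathbf e,\\ H_{41}&=(n-3,\,2n-7,\,n-5,\,n-5,\,-1,\,-2,\,-1)\,\mathbf e,\\ H_{42}&=(n-3,\,-1,\,n-3,\,-n+3,\,-1,\,0,\,1)\,\mathbf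 e,\\ H_{43}&=(n-3,\,n-4,\,-2,\,0,\,-1,\,0,\,1)\,\mathbf e,\\ H_{44}&=(n-3,\,-1,\,-1,\,1,\,-1,\,1,\,-1)\,\mathbf e,\\ H_{51}&=(n^2-7n+12,\,n^2-9n+20,\,-2n+10,\,-2n+8,\,2,\,2,\,0)\,\mathbf e,\\ H_{52}&=(n^2-7n+12,\,-2n+8,\,-n+6,\,n-4,\,2,\,-1,\,0)\,\mathbf e,\\ H_{61}&=(n^3-12n^2+47n-60,\,-3n^2+27n-60,\,6n-30,\,0,\,-6,\,0,\,0)\,\mathbf e. \end{align*}
   Context: $\chi^\mu$ denotes the irreducible character of $S_n$ indexed by $\mu\vdash n$, viewed as a function of cycle type. Binomial coefficients $\binom{m}{k}$ are the polynomials $m(m-1)\cdots(m-k+1)/k!$. For $n\le 5$, some of the indices $(n-2,2)$, $(n-3,3)$, $(n-3,2,1)$, $(n-3,1,1,1)$ are not partitions, and then $e_i$ is just the function defined by the displayed formula. -}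

module Defs where

open import Data.Nat as ℕ using (ℕ; zero; suc; _≤_; _≟_)
open import Data.Integer as ℤ using (ℤ; +_)
open import Data.Rational using (ℚ; _+_; _*_; _-_; -_; _/_; 0ℚ; 1ℚ)
open import Data.List using (List; length; filter)
open import Data.Nat.ListAction using (sum)
open import Data.Product using (_×_)
open import Data.List.Relation.Unary.All using (All)
open import Data.Vec using (Vec; []; _∷_)
open import Relation.Binary.PropositionalEquality using (_≡_)

ℚ[_] : ℕ → ℚ
ℚ[ n ] = (+ n) / 1

-- Binomial coefficient as a polynomial in m:
-- binom m k = m (m-1) ... (m-k+1) / k!
binom : ℚ → ℕ → ℚ
binom m zero    = 1ℚ
binom m (suc k) = binom m k * (m - ℚ[ k ]) * ((+ 1) / suc k)

-- λ ⊢ n : a (finite multiset, represented as a list of) positive parts summing to n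
IsPartition : ℕ → List ℕ → Set
IsPartition n λ′ = All (λ x → 1 ≤ x) λ′ × sum λ′ ≡ n

mult : ℕ → List ℕ → ℕ
mult j λ′ = length (filter (λ x → x ≟ j) λ′)

dot : ∀ {k} → Vec ℚ k → Vec ℚ k → ℚ
dot []       []       = 0ℚ
dot (a ∷ as) (b ∷ bs) = a * b + dot as bs

evec : ℚ → ℚ → ℚ → Vec ℚ 7
evec p q r =
  1ℚ ∷
  (p - 1ℚ) ∷
  (binom (p - 1ℚ) 2 + q - 1ℚ) ∷
  (binom (p - 1ℚ) 2 - q) ∷
  (binom (p - 1ℚ) 3 + (p - 1ℚ) * (q - 1ℚ) + r) ∷
  (ℚ[ 2 ] * binom (p - 1ℚ) 3 - p - r + ℚ[ 2 ]) ∷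
  (binom (p - 1ℚ) 3 - q * (p - 1ℚ) + r) ∷ []

{-# OPTIONS --safe #-}
-- Each eᵢ is a polynomial in p, q, r, so every claimed identity is an identity
-- between polynomials in p, q, r and n over ℚ.
module Submission where

open import Defs
open import Data.Nat using (ℕ; zero; suc; _≤_)
open import Data.Fin using (#_)
open import Data.Integer using (+_)
open import Data.Rational using (ℚ; _+_; _*_; _-_; -_; _/_; 0ℚ; 1ℚ)
open import Data.Rational.Solver using (module +-*-Solver)
open +-*-Solver using (Polynomial; con; var; _:+_; _:*_; _:-_; :-_; ⟦_⟧; ⟦_⟧↓; prove)
open import Data.List using (List)
open import Data.Vec using (Vec; []; _∷_)
open import Data.Product using (_×_; _,_)
open import Relation.Binary.PropositionalEquality using (_≡_; refl)

Poly : Set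
Poly = Polynomial 4

p̂ q̂ r̂ n̂ : Poly
p̂ = var (# 0)
q̂ = var (# 1)
r̂ = var (# 2)
n̂ = var (# 3)

ĉ : ℕ → Poly
ĉ k = con ℚ[ k ]

0̂ 1̂ : Poly
0̂ = con 0ℚ
1̂ = con 1ℚ

-- Syntactic copies of binom, dot and evec: ⟦_⟧ maps them, and the polynomials
-- below, definitionally onto the expressions of the statement.
binomᴾ : Poly → ℕ → Poly
binomᴾ m zero    = 1̂
binomᴾ m (suc k) = binomᴾ m k :* (m :- ĉ k) :* con ((+ 1) / suc k)

dotᴾ : ∀ {k} → Vec Poly k → Vec Poly k → Poly
dotᴾ []       []       = 0̂
dotᴾ (a ∷ as) (b ∷ bs) = a :* b :+ dotᴾ as bs

eᴾ : Vec Poly 7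
eᴾ =
  1̂ ∷
  (p̂ :- 1̂) ∷
  (binomᴾ (p̂ :- 1̂) 2 :+ q̂ :- 1̂) ∷
  (binomᴾ (p̂ :- 1̂) 2 :- q̂) ∷
  (binomᴾ (p̂ :- 1̂) 3 :+ (p̂ :- 1̂) :* (q̂ :- 1̂) :+ r̂) ∷
  (ĉ 2 :* binomᴾ (p̂ :- 1̂) 3 :- p̂ :- r̂ :+ ĉ 2) ∷
  (binomᴾ (p̂ :- 1̂) 3 :- q̂ :* (p̂ :- 1̂) :+ r̂) ∷ []

H₃₁ H₃₂ H₃₃ H₄₁ H₄₂ H₄₃ H₄₄ H₅₁ H₅₂ H₆₁ : Poly
H₃₁ = p̂ :* (p̂ :- 1̂) :* (p̂ :- ĉ 2)
H₃₂ = ĉ 2 :* p̂ :* q̂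
H₃₃ = ĉ 3 :* r̂
H₄₁ = p̂ :* (p̂ :- 1̂) :* (n̂ :- p̂)
H₄₂ = ĉ 2 :* q̂ :* (n̂ :- p̂ :- ĉ 2)
H₄₃ = p̂ :* (n̂ :- p̂ :- ĉ 2 :* q̂)
H₄₄ = n̂ :- p̂ :- ĉ 2 :* q̂ :- ĉ 3 :* r̂
H₅₁ = p̂ :* p̂ :* p̂ :+ ĉ 3 :* p̂ :* p̂ :+ ĉ 2 :* p̂ :* q̂
      :- n̂ :* (ĉ 2 :* p̂ :* p̂ :+ ĉ 3 :* p̂) :+ n̂ :* n̂ :* p̂
H₅₂ = p̂ :* p̂ :+ ĉ 4 :* p̂ :+ ĉ 2 :* p̂ :* q̂ :+ ĉ 8 :* q̂ :+ ĉ 3 :* r̂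
      :- n̂ :* (ĉ 2 :* p̂ :+ ĉ 2 :* q̂ :+ ĉ 4) :+ n̂ :* n̂
H₆₁ = :- (p̂ :* p̂ :* p̂) :- ĉ 9 :* p̂ :* p̂ :- ĉ 20 :* p̂ :- ĉ 6 :* p̂ :* q̂
      :- ĉ 24 :* q̂ :- ĉ 6 :* r̂
      :+ n̂ :* (ĉ 3 :* p̂ :* p̂ :+ ĉ 18 :* p̂ :+ ĉ 6 :* q̂ :+ ĉ 20)
      :- n̂ :* n̂ :* (ĉ 3 :* p̂ :+ ĉ 9) :+ n̂ :* n̂ :* n̂

row₃₁ row₃₂ row₃₃ row₄₁ row₄₂ row₄₃ row₄₄ row₅₁ row₅₂ row₆₁ : Vec Poly 7
row₃₁ = 1̂ ∷ ĉ 3 ∷ ĉ 3 ∷ ĉ 3 ∷ 1̂ ∷ ĉ 2 ∷ 1̂ ∷ []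
row₃₂ = 1̂ ∷ 1̂ ∷ 1̂ ∷ :- 1̂ ∷ 1̂ ∷ 0̂ ∷ :- 1̂ ∷ []
row₃₃ = 1̂ ∷ 0̂ ∷ 0̂ ∷ 0̂ ∷ 1̂ ∷ :- 1̂ ∷ 1̂ ∷ []
row₄₁ = (n̂ :- ĉ 3) ∷ (ĉ 2 :* n̂ :- ĉ 7) ∷ (n̂ :- ĉ 5) ∷ (n̂ :- ĉ 5)
        ∷ :- 1̂ ∷ :- ĉ 2 ∷ :- 1̂ ∷ []
row₄₂ = (n̂ :- ĉ 3) ∷ :- 1̂ ∷ (n̂ :- ĉ 3) ∷ (:- n̂ :+ ĉ 3) ∷ :- 1̂ ∷ 0̂ ∷ 1̂ ∷ []
row₄₃ = (n̂ :- ĉ 3) ∷ (n̂ :- ĉ 4) ∷ :- ĉ 2 ∷ 0̂ ∷ :- 1̂ ∷ 0̂ ∷ 1̂ ∷ []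
row₄₄ = (n̂ :- ĉ 3) ∷ :- 1̂ ∷ :- 1̂ ∷ 1̂ ∷ :- 1̂ ∷ 1̂ ∷ :- 1̂ ∷ []
row₅₁ = (n̂ :* n̂ :- ĉ 7 :* n̂ :+ ĉ 12) ∷ (n̂ :* n̂ :- ĉ 9 :* n̂ :+ ĉ 20)
        ∷ (:- (ĉ 2 :* n̂) :+ ĉ 10) ∷ (:- (ĉ 2 :* n̂) :+ ĉ 8) ∷ ĉ 2 ∷ ĉ 2 ∷ 0̂ ∷ []
row₅₂ = (n̂ :* n̂ :- ĉ 7 :* n̂ :+ ĉ 12) ∷ (:- (ĉ 2 :* n̂) :+ ĉ 8)
        ∷ (:- n̂ :+ ĉ 6) ∷ (n̂ :- ĉ 4) ∷ ĉ 2 ∷ :- 1̂ ∷ 0̂ ∷ []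
row₆₁ = (n̂ :* n̂ :* n̂ :- ĉ 12 :* n̂ :* n̂ :+ ĉ 47 :* n̂ :- ĉ 60)
        ∷ (:- (ĉ 3 :* n̂ :* n̂) :+ ĉ 27 :* n̂ :- ĉ 60)
        ∷ (ĉ 6 :* n̂ :- ĉ 30) ∷ 0̂ ∷ :- ĉ 6 ∷ 0̂ ∷ 0̂ ∷ []

lemma3p4 : (n : ℕ) → 3 ≤ n → (lam : List ℕ) → IsPartition n lam →
    let N = ℚ[ n ]
        p = ℚ[ mult 1 lam ]
        q = ℚ[ mult 2 lam ]
        r = ℚ[ mult 3 lam ]
        e = evec p q r
    in (p * (p - 1ℚ) * (p - ℚ[ 2 ])
          ≡ dot (1ℚ ∷ ℚ[ 3 ] ∷ ℚ[ 3 ] ∷ ℚ[ 3 ] ∷ 1ℚ ∷ ℚ[ 2 ] ∷ 1ℚ ∷ []) e)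
     × (ℚ[ 2 ] * p * q
          ≡ dot (1ℚ ∷ 1ℚ ∷ 1ℚ ∷ - 1ℚ ∷ 1ℚ ∷ 0ℚ ∷ - 1ℚ ∷ []) e)
     × (ℚ[ 3 ] * r
          ≡ dot (1ℚ ∷ 0ℚ ∷ 0ℚ ∷ 0ℚ ∷ 1ℚ ∷ - 1ℚ ∷ 1ℚ ∷ []) e)
     × (p * (p - 1ℚ) * (N - p)
          ≡ dot ((N - ℚ[ 3 ]) ∷ (ℚ[ 2 ] * N - ℚ[ 7 ]) ∷ (N - ℚ[ 5 ]) ∷ (N - ℚ[ 5 ])
                 ∷ - 1ℚ ∷ - ℚ[ 2 ] ∷ - 1ℚ ∷ []) e)
     × (ℚ[ 2 ] * q * (N - p - ℚ[ 2 ])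
          ≡ dot ((N - ℚ[ 3 ]) ∷ - 1ℚ ∷ (N - ℚ[ 3 ]) ∷ (- N + ℚ[ 3 ])
                 ∷ - 1ℚ ∷ 0ℚ ∷ 1ℚ ∷ []) e)
     × (p * (N - p - ℚ[ 2 ] * q)
          ≡ dot ((N - ℚ[ 3 ]) ∷ (N - ℚ[ 4 ]) ∷ - ℚ[ 2 ] ∷ 0ℚ ∷ - 1ℚ ∷ 0ℚ ∷ 1ℚ ∷ []) e)
     × (N - p - ℚ[ 2 ] * q - ℚ[ 3 ] * r
          ≡ dot ((N - ℚ[ 3 ]) ∷ - 1ℚ ∷ - 1ℚ ∷ 1ℚ ∷ - 1ℚ ∷ 1ℚ ∷ - 1ℚ ∷ []) e)
     × (p * p * p + ℚ[ 3 ] * p * p + ℚ[ 2 ] * p * q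
          - N * (ℚ[ 2 ] * p * p + ℚ[ 3 ] * p) + N * N * p
          ≡ dot ((N * N - ℚ[ 7 ] * N + ℚ[ 12 ]) ∷ (N * N - ℚ[ 9 ] * N + ℚ[ 20 ])
                 ∷ (- (ℚ[ 2 ] * N) + ℚ[ 10 ]) ∷ (- (ℚ[ 2 ] * N) + ℚ[ 8 ])
                 ∷ ℚ[ 2 ] ∷ ℚ[ 2 ] ∷ 0ℚ ∷ []) e)
     × (p * p + ℚ[ 4 ] * p + ℚ[ 2 ] * p * q + ℚ[ 8 ] * q + ℚ[ 3 ] * r
          - N * (ℚ[ 2 ] * p + ℚ[ 2 ] * q + ℚ[ 4 ]) + N * N
          ≡ dot ((N * N - ℚ[ 7 ] * N + ℚ[ 12 ]) ∷ (- (ℚ[ 2 ] * N) + ℚ[ 8 ])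
                 ∷ (- N + ℚ[ 6 ]) ∷ (N - ℚ[ 4 ]) ∷ ℚ[ 2 ] ∷ - 1ℚ ∷ 0ℚ ∷ []) e)
     × (- (p * p * p) - ℚ[ 9 ] * p * p - ℚ[ 20 ] * p - ℚ[ 6 ] * p * q
          - ℚ[ 24 ] * q - ℚ[ 6 ] * r
          + N * (ℚ[ 3 ] * p * p + ℚ[ 18 ] * p + ℚ[ 6 ] * q + ℚ[ 20 ])
          - N * N * (ℚ[ 3 ] * p + ℚ[ 9 ]) + N * N * N
          ≡ dot ((N * N * N - ℚ[ 12 ] * N * N + ℚ[ 47 ] * N - ℚ[ 60 ])
                 ∷ (- (ℚ[ 3 ] * N * N) + ℚ[ 27 ] * N - ℚ[ 60 ])
                 ∷ (ℚ[ 6 ] * N - ℚ[ 30 ]) ∷ 0ℚ ∷ - ℚ[ 6 ] ∷ 0ℚ ∷ 0ℚ ∷ []) e)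
lemma3p4 n _ lam _ =
    expand H₃₁ row₃₁ refl , expand H₃₂ row₃₂ refl , expand H₃₃ row₃₃ refl
  , expand H₄₁ row₄₁ refl , expand H₄₂ row₄₂ refl , expand H₄₃ row₄₃ refl
  , expand H₄₄ row₄₄ refl , expand H₅₁ row₅₁ refl , expand H₅₂ row₅₂ refl
  , expand H₆₁ row₆₁ refl
  where
  ρ : Vec ℚ 4
  ρ = ℚ[ mult 1 lam ] ∷ ℚ[ mult 2 lam ] ∷ ℚ[ mult 3 lam ] ∷ ℚ[ n ] ∷ []

  expand : (H : Poly) (row : Vec Poly 7) →
           ⟦ H ⟧↓ ρ ≡ ⟦ dotᴾ row eᴾ ⟧↓ ρ → ⟦ H ⟧ ρ ≡ ⟦ dotᴾ row eᴾ ⟧ ρ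
  expand H row = prove ρ H (dotᴾ row eᴾ)
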